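{- Let $F$ and $H$ be sets of clauses that do not share variables and are both unsatisfiable. Let $F\cdot H=\{\gamma\vee\delta : \gamma\in F,\ \delta\in H\}$. Then the tree obtained by replacing every empty subtree of an optimal backtracking search tree of $F$ with an optimal backtracking search tree of $H$ is an optimal backtracking search tree of $F\cdot H$.
   Context: A formula is a finite set of clauses. $F|I$ denotes $F$ simplified under the partial assignment $I$ (clauses with a true literal removed, false literals deleted); $Var(F)$ is its set of variables. A binary tree is either the empty tree $()$ or $(x~T_1~T_2)$; its size is its number of nodes; its empty subtrees are all occurrences of $()$ inside it (a tree with $s$ nodes has $s+1$ of them). A backtracking search tree (BST) of $F$ is $()$ if $F$ contains the empty clause, and otherwise $(x~T_1~T_2)$ with $x\in Var(F)$ and $T_1,T_2$ BSTs of $F|\{\neg x\}$ and $F|\{x\}$. An optimal BST is one of minimum size. -}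

module Defs where

open import Data.Nat using (ℕ; zero; suc; _+_; _≤_; _≟_)
open import Data.Bool using (Bool; true; false; _∧_; not; if_then_else_)
open import Data.Bool.Properties using () renaming (_≟_ to _≟ᵇ_)
open import Data.Product using (Σ; _×_; _,_; proj₁; proj₂)
open import Data.List using (List; []; _∷_; _++_; map; concatMap)
open import Data.Bool.ListAction using (any)
open import Data.List.Relation.Unary.Any using (Any)
open import Data.List.Relation.Unary.All using (All)
open import Data.List.Membership.Propositional using (_∈_)
open import Relation.Nullary using (¬_; Dec; yes; no)
open import Relation.Nullary.Decidable using (⌊_⌋)
open import Relation.Binary.PropositionalEquality using (_≡_)

Var : Set
Var = ℕ

-- A literal is a variable with a polarity (true = positive literal x, false = ¬x).
record Literal : Set where
  constructor lit
  field
    var : Var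
    pol : Bool
open Literal public

-- Clauses and formulas: finite sets represented as lists (membership semantics).
Clause : Set
Clause = List Literal

Formula : Set
Formula = List Clause

_∈Var_ : Var → Formula → Set
x ∈Var F = Any (λ C → Any (λ l → var l ≡ x) C) F

Assignment : Set
Assignment = Var → Bool

litTrue : Assignment → Literal → Set
litTrue α l = α (var l) ≡ pol l

Satisfies : Assignment → Formula → Set
Satisfies α F = All (λ C → Any (litTrue α) C) F

Satisfiable : Formula → Set
Satisfiable F = Σ Assignment (λ α → Satisfies α F)

Unsatisfiable : Formula → Set
Unsatisfiable F = ¬ Satisfiable F

isTrueUnder : Var → Bool → Literal → Bool
isTrueUnder x b l = ⌊ var l ≟ x ⌋ ∧ ⌊ pol l ≟ᵇ b ⌋

mentions : Var → Literal → Bool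
mentions x l = ⌊ var l ≟ x ⌋

restrict : Formula → Var → Bool → Formula
restrict [] x b = []
restrict (C ∷ F) x b with any (isTrueUnder x b) C
... | true  = restrict F x b
... | false = filterNot C ∷ restrict F x b
  where
  filterNot : Clause → Clause
  filterNot [] = []
  filterNot (l ∷ ls) = if mentions x l then filterNot ls else l ∷ filterNot ls

HasEmptyClause : Formula → Set
HasEmptyClause F = Any (λ C → C ≡ []) F

data Tree : Set where
  ε    : Tree
  node : Var → Tree → Tree → Tree

size : Tree → ℕ
size ε = zero
size (node _ l r) = suc (size l + size r)

data IsBST : Formula → Tree → Set where
  bst-leaf : ∀ {F} → HasEmptyClause F → IsBST F ε
  bst-node : ∀ {F x T₁ T₂} → ¬ HasEmptyClause F → x ∈Var F →
             IsBST (restrict F x false) T₁ → IsBST (restrict F x true) T₂ →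
             IsBST F (node x T₁ T₂)

OptimalBST : Formula → Tree → Set
OptimalBST F T = IsBST F T × (∀ T′ → IsBST F T′ → size T ≤ size T′)

_·_ : Formula → Formula → Formula
F · H = concatMap (λ γ → map (λ δ → γ ++ δ) H) F

replaceLeaves : Tree → Tree → Tree
replaceLeaves ε S = S
replaceLeaves (node x l r) S = node x (replaceLeaves l S) (replaceLeaves r S)

NoSharedVars : Formula → Formula → Set
NoSharedVars F H = ∀ x → x ∈Var F → ¬ (x ∈Var H)

-- Restricting F · H on a variable of F restricts the left factor, and on a variable
-- of H the right one. Hence plugging a BST of H into every leaf of a BST of F gives a
-- BST of F · H, whose number of leaves (empty subtrees) is the product of theirs.
-- Conversely, every BST T of F · H yields BSTs A of F and B of H with
-- leaves A * leaves B ≤ leaves T, by induction on T: at a node on a variable of F,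
-- join the two F-trees of the branches under that node and keep the H-tree with fewer
-- leaves, since (a₁ + a₂) * min b₁ b₂ ≤ a₁ * b₁ + a₂ * b₂; nodes on variables of H
-- are symmetric. Comparing leaves, the composed tree is optimal.
module Submission where

open import Defs
open import Data.Bool using (Bool; true; false; _∨_; _∧_; not; if_then_else_)
open import Data.Bool.Properties using (∨-assoc; ∨-identityʳ)
open import Data.Bool.ListAction using (any)
open import Data.Empty using (⊥-elim)
open import Data.List using ([]; _∷_; _++_; map; filterᵇ; fromMaybe)
open import Data.List.Properties
  using (∷-injectiveˡ; ++-assoc; ++-conicalˡ; ++-conicalʳ; map-++; filter-++; concatMap-++)
open import Data.List.Membership.Propositional using (_∈_; find; lose)
open import Data.List.Relation.Unary.All using ([])
open import Data.List.Relation.Unary.Any as Any using (Any; here; there; any?)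
open import Data.List.Relation.Unary.Any.Properties
  using (++⁺ˡ; ++⁻; filter⁻; map⁺; map⁻; concatMap⁺; concatMap⁻)
open import Data.Maybe using (Maybe; just; nothing) renaming (map to mapᵐ)
open import Data.Nat using (ℕ; suc; _+_; _*_; _≤_; s≤s; z≤n; _≟_)
open import Data.Nat.Properties
  using (+-suc; +-comm; *-comm; *-identityˡ; *-distribʳ-+; +-mono-≤; *-mono-≤; *-monoˡ-≤; *-monoʳ-≤;
         ≤-refl; ≤-reflexive; ≤-trans; ≤-total; ≤-pred; module ≤-Reasoning)
open import Data.Product using (∃-syntax; ∃₂; _×_; _,_; proj₁; proj₂)
open import Data.Sum as Sum using (_⊎_; inj₁; inj₂)
open import Function using (_∘_)
open import Relation.Nullary using (¬_; Dec; yes; no)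
open import Relation.Nullary.Decidable using (dec-false; isYes≗does)
open import Relation.Binary.PropositionalEquality
  using (_≡_; _≢_; refl; sym; trans; cong; cong₂; subst; module ≡-Reasoning)

_∈Varᶜ_ : Var → Clause → Set
x ∈Varᶜ C = Any (λ l → var l ≡ x) C

any-++ : ∀ {A : Set} (p : A → Bool) xs ys → any p (xs ++ ys) ≡ any p xs ∨ any p ys
any-++ p []       ys = refl
any-++ p (a ∷ xs) ys =
  trans (cong (p a ∨_) (any-++ p xs ys)) (sym (∨-assoc (p a) (any p xs) (any p ys)))

mentions-≢ : ∀ {x} l → var l ≢ x → mentions x l ≡ false
mentions-≢ {x} l l≢x = trans (isYes≗does (var l ≟ x)) (dec-false (var l ≟ x) l≢x)

any-isTrueUnder-∉ : ∀ {x C} b → ¬ x ∈Varᶜ C → any (isTrueUnder x b) C ≡ false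
any-isTrueUnder-∉ {C = []}    b x∉C = refl
any-isTrueUnder-∉ {x} {l ∷ C} b x∉C =
  cong₂ _∨_ (cong (_∧ _) (mentions-≢ l (x∉C ∘ here))) (any-isTrueUnder-∉ b (x∉C ∘ there))

deleteVar : Var → Clause → Clause
deleteVar x = filterᵇ (not ∘ mentions x)

deleteVar-++ : ∀ x γ δ → deleteVar x (γ ++ δ) ≡ deleteVar x γ ++ deleteVar x δ
deleteVar-++ x = filter-++ _

deleteVar-∉ : ∀ {x C} → ¬ x ∈Varᶜ C → deleteVar x C ≡ C
deleteVar-∉ {C = []}    x∉C = refl
deleteVar-∉ {x} {l ∷ C} x∉C rewrite mentions-≢ l (x∉C ∘ here) =
  cong (l ∷_) (deleteVar-∉ (x∉C ∘ there))

restrictClause : Var → Bool → Clause → Maybe Clause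
restrictClause x b C = if any (isTrueUnder x b) C then nothing else just (deleteVar x C)

restrictClause-++ˡ : ∀ {x δ} b γ → ¬ x ∈Varᶜ δ →
  restrictClause x b (γ ++ δ) ≡ mapᵐ (_++ δ) (restrictClause x b γ)
restrictClause-++ˡ {x} {δ} b γ x∉δ
  rewrite any-++ (isTrueUnder x b) γ δ | any-isTrueUnder-∉ b x∉δ
        | ∨-identityʳ (any (isTrueUnder x b) γ) | deleteVar-++ x γ δ | deleteVar-∉ x∉δ
  with any (isTrueUnder x b) γ
... | true  = refl
... | false = refl

restrictClause-++ʳ : ∀ {x γ} b δ → ¬ x ∈Varᶜ γ →
  restrictClause x b (γ ++ δ) ≡ mapᵐ (γ ++_) (restrictClause x b δ)
restrictClause-++ʳ {x} {γ} b δ x∉γ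
  rewrite any-++ (isTrueUnder x b) γ δ | any-isTrueUnder-∉ b x∉γ
        | deleteVar-++ x γ δ | deleteVar-∉ x∉γ
  with any (isTrueUnder x b) δ
... | true  = refl
... | false = refl

-- restrict deletes literals with a helper local to its definition, which cannot be
-- named here; this equation trades it for deleteVar. The induction on C goes through
-- because the helper ignores its other parameters, so Agda identifies its instances.
restrict-∷ : ∀ C F x b → restrict (C ∷ F) x b ≡ fromMaybe (restrictClause x b C) ++ restrict F x b
restrict-∷ []      F x b = refl
restrict-∷ (l ∷ C) F x b with isTrueUnder x b l | any (isTrueUnder x b) C | restrict-∷ C F x b
... | true  | _     | _ = refl
... | false | true  | _ = refl
... | false | false | ih with mentions x l
...   | true  = ih
...   | false = cong (λ C′ → (l ∷ C′) ∷ restrict F x b) (∷-injectiveˡ ih)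

restrict-++ : ∀ F G x b → restrict (F ++ G) x b ≡ restrict F x b ++ restrict G x b
restrict-++ []      G x b = refl
restrict-++ (C ∷ F) G x b = begin
  restrict (C ∷ F ++ G) x b                 ≡⟨ restrict-∷ C (F ++ G) x b ⟩
  C′ ++ restrict (F ++ G) x b               ≡⟨ cong (C′ ++_) (restrict-++ F G x b) ⟩
  C′ ++ restrict F x b ++ restrict G x b    ≡⟨ ++-assoc C′ _ _ ⟨
  (C′ ++ restrict F x b) ++ restrict G x b  ≡⟨ cong (_++ restrict G x b) (restrict-∷ C F x b) ⟨
  restrict (C ∷ F) x b ++ restrict G x b    ∎
  where
  open ≡-Reasoning
  C′ = fromMaybe (restrictClause x b C)

restrictClause-∈Var : ∀ {y} C x b → y ∈Var fromMaybe (restrictClause x b C) → y ∈Varᶜ C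
restrictClause-∈Var C x b y∈ with any (isTrueUnder x b) C
restrictClause-∈Var C x b (here y∈C′) | false = filter⁻ _ y∈C′

restrict-∈Var : ∀ {y} F x b → y ∈Var restrict F x b → y ∈Var F
restrict-∈Var (C ∷ F) x b y∈
  with ++⁻ (fromMaybe (restrictClause x b C)) (subst (_ ∈Var_) (restrict-∷ C F x b) y∈)
... | inj₁ y∈C′ = here (restrictClause-∈Var C x b y∈C′)
... | inj₂ y∈F′ = there (restrict-∈Var F x b y∈F′)

NoSharedVars-restrictˡ : ∀ {F H} x b → NoSharedVars F H → NoSharedVars (restrict F x b) H
NoSharedVars-restrictˡ x b disj y y∈F′ = disj y (restrict-∈Var _ x b y∈F′)

NoSharedVars-restrictʳ : ∀ {F H} x b → NoSharedVars F H → NoSharedVars F (restrict H x b)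
NoSharedVars-restrictʳ x b disj y y∈F y∈H′ = disj y y∈F (restrict-∈Var _ x b y∈H′)

·-++ˡ : ∀ F G H → (F ++ G) · H ≡ F · H ++ G · H
·-++ˡ F G H = concatMap-++ (λ γ → map (γ ++_) H) F G

restrict-map-++ˡ : ∀ {x} γ H b → ¬ x ∈Var H →
  restrict (map (γ ++_) H) x b ≡ fromMaybe (restrictClause x b γ) · H
restrict-map-++ˡ {x} γ [] b x∉H with restrictClause x b γ
... | nothing = refl
... | just _  = refl
restrict-map-++ˡ {x} γ (δ ∷ H) b x∉H
  rewrite restrict-∷ (γ ++ δ) (map (γ ++_) H) x b | restrictClause-++ˡ b γ (x∉H ∘ here)
        | restrict-map-++ˡ γ H b (x∉H ∘ there)
  with restrictClause x b γ
... | nothing = refl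
... | just _  = refl

restrict-map-++ʳ : ∀ {x} γ H b → ¬ x ∈Varᶜ γ →
  restrict (map (γ ++_) H) x b ≡ map (γ ++_) (restrict H x b)
restrict-map-++ʳ γ []      b x∉γ = refl
restrict-map-++ʳ {x} γ (δ ∷ H) b x∉γ = begin
  restrict ((γ ++ δ) ∷ map (γ ++_) H) x b               ≡⟨ restrict-∷ (γ ++ δ) _ x b ⟩
  fromMaybe (r (γ ++ δ)) ++ restrict (map (γ ++_) H) x b
    ≡⟨ cong₂ _++_ (cong fromMaybe (restrictClause-++ʳ b δ x∉γ)) (restrict-map-++ʳ γ H b x∉γ) ⟩
  fromMaybe (mapᵐ (γ ++_) (r δ)) ++ map (γ ++_) (restrict H x b)
    ≡⟨ cong (_++ _) (fromMaybe-map (r δ)) ⟩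
  map (γ ++_) (fromMaybe (r δ)) ++ map (γ ++_) (restrict H x b)
    ≡⟨ map-++ (γ ++_) (fromMaybe (r δ)) (restrict H x b) ⟨
  map (γ ++_) (fromMaybe (r δ) ++ restrict H x b)      ≡⟨ cong (map (γ ++_)) (restrict-∷ δ H x b) ⟨
  map (γ ++_) (restrict (δ ∷ H) x b)                   ∎
  where
  open ≡-Reasoning
  r = restrictClause x b
  fromMaybe-map : ∀ m → fromMaybe (mapᵐ (γ ++_) m) ≡ map (γ ++_) (fromMaybe m)
  fromMaybe-map nothing  = refl
  fromMaybe-map (just _) = refl

restrict-·ˡ : ∀ {x} F H b → ¬ x ∈Var H → restrict (F · H) x b ≡ restrict F x b · H
restrict-·ˡ []      H b x∉H = refl
restrict-·ˡ {x} (γ ∷ F) H b x∉H = begin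
  restrict (map (γ ++_) H ++ F · H) x b                 ≡⟨ restrict-++ (map (γ ++_) H) (F · H) x b ⟩
  restrict (map (γ ++_) H) x b ++ restrict (F · H) x b
    ≡⟨ cong₂ _++_ (restrict-map-++ˡ γ H b x∉H) (restrict-·ˡ F H b x∉H) ⟩
  γ′ · H ++ restrict F x b · H                          ≡⟨ ·-++ˡ γ′ (restrict F x b) H ⟨
  (γ′ ++ restrict F x b) · H                            ≡⟨ cong (_· H) (restrict-∷ γ F x b) ⟨
  restrict (γ ∷ F) x b · H                              ∎
  where
  open ≡-Reasoning
  γ′ = fromMaybe (restrictClause x b γ)

restrict-·ʳ : ∀ {x} F H b → ¬ x ∈Var F → restrict (F · H) x b ≡ F · restrict H x b
restrict-·ʳ []      H b x∉F = refl
restrict-·ʳ {x} (γ ∷ F) H b x∉F = begin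
  restrict (map (γ ++_) H ++ F · H) x b                 ≡⟨ restrict-++ (map (γ ++_) H) (F · H) x b ⟩
  restrict (map (γ ++_) H) x b ++ restrict (F · H) x b
    ≡⟨ cong₂ _++_ (restrict-map-++ʳ γ H b (x∉F ∘ here)) (restrict-·ʳ F H b (x∉F ∘ there)) ⟩
  map (γ ++_) (restrict H x b) ++ F · restrict H x b    ∎
  where open ≡-Reasoning

·-Any⁺ : ∀ {P : Clause → Set} {F H γ δ} → γ ∈ F → δ ∈ H → P (γ ++ δ) → Any P (F · H)
·-Any⁺ γ∈F δ∈H p = concatMap⁺ _ (lose γ∈F (map⁺ (lose δ∈H p)))

·-Any⁻ : ∀ {P : Clause → Set} F H → Any P (F · H) → ∃₂ λ γ δ → γ ∈ F × δ ∈ H × P (γ ++ δ)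
·-Any⁻ F H p with find (concatMap⁻ _ {xs = F} p)
... | γ , γ∈F , q with find (map⁻ q)
...   | δ , δ∈H , r = γ , δ , γ∈F , δ∈H , r

·-∈Var⁻ : ∀ {x} F H → x ∈Var (F · H) → x ∈Var F ⊎ x ∈Var H
·-∈Var⁻ F H x∈ with ·-Any⁻ F H x∈
... | γ , δ , γ∈F , δ∈H , x∈γδ = Sum.map (lose γ∈F) (lose δ∈H) (++⁻ γ x∈γδ)

·-∈Varˡ : ∀ {x F} H → H ≢ [] → x ∈Var F → x ∈Var (F · H)
·-∈Varˡ []      H≢[] x∈F = ⊥-elim (H≢[] refl)
·-∈Varˡ (δ ∷ H) H≢[] x∈F with find x∈F
... | γ , γ∈F , x∈γ = ·-Any⁺ γ∈F (here refl) (++⁺ˡ x∈γ)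

·-∈Varʳ : ∀ {x F H} → HasEmptyClause F → x ∈Var H → x ∈Var (F · H)
·-∈Varʳ F∋[] x∈H with find x∈H
... | δ , δ∈H , x∈δ = ·-Any⁺ (Any.map sym F∋[]) δ∈H x∈δ

·-hasEmptyClause⁺ : ∀ {F H} → HasEmptyClause F → HasEmptyClause H → HasEmptyClause (F · H)
·-hasEmptyClause⁺ F∋[] H∋[] = ·-Any⁺ (Any.map sym F∋[]) (Any.map sym H∋[]) refl

·-hasEmptyClause⁻ : ∀ F H → HasEmptyClause (F · H) → HasEmptyClause F × HasEmptyClause H
·-hasEmptyClause⁻ F H FH∋[] with ·-Any⁻ F H FH∋[]
... | γ , δ , γ∈F , δ∈H , γδ≡[] =
  lose γ∈F (++-conicalˡ γ δ γδ≡[]) , lose δ∈H (++-conicalʳ γ δ γδ≡[])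

isEmpty? : (C : Clause) → Dec (C ≡ [])
isEmpty? []      = yes refl
isEmpty? (_ ∷ _) = no λ ()

hasEmptyClause? : (F : Formula) → Dec (HasEmptyClause F)
hasEmptyClause? = any? isEmpty?

IsBST-·ʳ : ∀ F H {T} → HasEmptyClause F → NoSharedVars F H → IsBST H T → IsBST (F · H) T
IsBST-·ʳ F H F∋[] disj (bst-leaf H∋[]) = bst-leaf (·-hasEmptyClause⁺ F∋[] H∋[])
IsBST-·ʳ F H F∋[] disj (bst-node {x = x} H∌[] x∈H t₁ t₂) =
  bst-node (H∌[] ∘ proj₂ ∘ ·-hasEmptyClause⁻ F H) (·-∈Varʳ F∋[] x∈H)
           (branch false t₁) (branch true t₂)
  where
  branch : ∀ b {T} → IsBST (restrict H x b) T → IsBST (restrict (F · H) x b) T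
  branch b t = subst (λ G → IsBST G _) (sym (restrict-·ʳ F H b (λ x∈F → disj x x∈F x∈H)))
                 (IsBST-·ʳ F (restrict H x b) F∋[] (NoSharedVars-restrictʳ x b disj) t)

IsBST-replaceLeaves : ∀ F H {A B} → NoSharedVars F H → H ≢ [] → IsBST F A → IsBST H B →
  IsBST (F · H) (replaceLeaves A B)
IsBST-replaceLeaves F H disj H≢[] (bst-leaf F∋[]) t = IsBST-·ʳ F H F∋[] disj t
IsBST-replaceLeaves F H disj H≢[] (bst-node {x = x} F∌[] x∈F s₁ s₂) t =
  bst-node (F∌[] ∘ proj₁ ∘ ·-hasEmptyClause⁻ F H) (·-∈Varˡ H H≢[] x∈F)
           (branch false s₁) (branch true s₂)
  where
  branch : ∀ b {A} → IsBST (restrict F x b) A → IsBST (restrict (F · H) x b) (replaceLeaves A _)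
  branch b s = subst (λ G → IsBST G _) (sym (restrict-·ˡ F H b (disj x x∈F)))
                 (IsBST-replaceLeaves (restrict F x b) H (NoSharedVars-restrictˡ x b disj) H≢[] s t)

leaves : Tree → ℕ
leaves T = suc (size T)

leaves-node : ∀ x T₁ T₂ → leaves (node x T₁ T₂) ≡ leaves T₁ + leaves T₂
leaves-node x T₁ T₂ = cong suc (sym (+-suc (size T₁) (size T₂)))

≤-leaves-node : ∀ {m} x T₁ T₂ → m ≤ leaves T₁ + leaves T₂ → m ≤ leaves (node x T₁ T₂)
≤-leaves-node x T₁ T₂ m≤ = ≤-trans m≤ (≤-reflexive (sym (leaves-node x T₁ T₂)))

leaves-replaceLeaves : ∀ A B → leaves (replaceLeaves A B) ≡ leaves A * leaves B
leaves-replaceLeaves ε B = sym (*-identityˡ (leaves B))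
leaves-replaceLeaves (node x A₁ A₂) B = begin
  leaves (node x (replaceLeaves A₁ B) (replaceLeaves A₂ B))  ≡⟨ leaves-node x _ _ ⟩
  leaves (replaceLeaves A₁ B) + leaves (replaceLeaves A₂ B)
    ≡⟨ cong₂ _+_ (leaves-replaceLeaves A₁ B) (leaves-replaceLeaves A₂ B) ⟩
  leaves A₁ * leaves B + leaves A₂ * leaves B                ≡⟨ *-distribʳ-+ (leaves B) (leaves A₁) (leaves A₂) ⟨
  (leaves A₁ + leaves A₂) * leaves B                         ≡⟨ cong (_* leaves B) (leaves-node x A₁ A₂) ⟨
  leaves (node x A₁ A₂) * leaves B                           ∎
  where open ≡-Reasoning

IsBST-join : ∀ {F x A₁ A₂} → x ∈Var F → IsBST (restrict F x false) A₁ → IsBST (restrict F x true) A₂ →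
  ∃[ A ] IsBST F A × leaves A ≤ leaves A₁ + leaves A₂
IsBST-join {F} {x} {A₁} {A₂} x∈F s₁ s₂ with hasEmptyClause? F
... | yes F∋[] = ε , bst-leaf F∋[] , s≤s z≤n
... | no  F∌[] = node x A₁ A₂ , bst-node F∌[] x∈F s₁ s₂ , ≤-reflexive (leaves-node x A₁ A₂)

*-≤-min : ∀ {a a₁ a₂ b₁ b₂ t₁ t₂} → b₁ ≤ b₂ → a ≤ a₁ + a₂ → a₁ * b₁ ≤ t₁ → a₂ * b₂ ≤ t₂ →
  a * b₁ ≤ t₁ + t₂
*-≤-min {a} {a₁} {a₂} {b₁} {b₂} {t₁} {t₂} b₁≤b₂ a≤ a₁b₁≤ a₂b₂≤ = begin
  a * b₁             ≤⟨ *-monoˡ-≤ b₁ a≤ ⟩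
  (a₁ + a₂) * b₁     ≡⟨ *-distribʳ-+ b₁ a₁ a₂ ⟩
  a₁ * b₁ + a₂ * b₁  ≤⟨ +-mono-≤ a₁b₁≤ (≤-trans (*-monoʳ-≤ a₂ b₁≤b₂) a₂b₂≤) ⟩
  t₁ + t₂            ∎
  where open ≤-Reasoning

*-≤-splitˡ : ∀ {a a₁ a₂ b₁ b₂ t₁ t₂} → a ≤ a₁ + a₂ → a₁ * b₁ ≤ t₁ → a₂ * b₂ ≤ t₂ →
  a * b₁ ≤ t₁ + t₂ ⊎ a * b₂ ≤ t₁ + t₂
*-≤-splitˡ {a} {a₁} {a₂} {b₁} {b₂} {t₁} {t₂} a≤ a₁b₁≤ a₂b₂≤ with ≤-total b₁ b₂
... | inj₁ b₁≤b₂ = inj₁ (*-≤-min {a₁ = a₁} {a₂} b₁≤b₂ a≤ a₁b₁≤ a₂b₂≤)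
... | inj₂ b₂≤b₁ = inj₂ (subst (a * b₂ ≤_) (+-comm t₂ t₁)
                          (*-≤-min {a₁ = a₂} {a₁} b₂≤b₁ (subst (a ≤_) (+-comm a₁ a₂) a≤) a₂b₂≤ a₁b₁≤))

*-≤-splitʳ : ∀ {b a₁ a₂ b₁ b₂ t₁ t₂} → b ≤ b₁ + b₂ → a₁ * b₁ ≤ t₁ → a₂ * b₂ ≤ t₂ →
  a₁ * b ≤ t₁ + t₂ ⊎ a₂ * b ≤ t₁ + t₂
*-≤-splitʳ {b} {a₁} {a₂} {b₁} {b₂} b≤ a₁b₁≤ a₂b₂≤ =
  Sum.map (commute b a₁) (commute b a₂)
    (*-≤-splitˡ {a₁ = b₁} {b₂} b≤ (commute a₁ b₁ a₁b₁≤) (commute a₂ b₂ a₂b₂≤))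
  where
  commute : ∀ m n {t} → m * n ≤ t → n * m ≤ t
  commute m n {t} = subst (_≤ t) (*-comm m n)

record Factorisation (F H : Formula) (T : Tree) : Set where
  constructor factorisation
  field
    {left right} : Tree
    left-isBST   : IsBST F left
    right-isBST  : IsBST H right
    leaves-≤     : leaves left * leaves right ≤ leaves T

factorisation-nodeˡ : ∀ {F H x T₁ T₂} → x ∈Var F →
  Factorisation (restrict F x false) H T₁ → Factorisation (restrict F x true) H T₂ →
  Factorisation F H (node x T₁ T₂)
factorisation-nodeˡ {x = x} {T₁} {T₂} x∈F
  (factorisation {right = B₁} s₁ t₁ ≤T₁) (factorisation {right = B₂} s₂ t₂ ≤T₂)
  with IsBST-join x∈F s₁ s₂
... | _ , s , A≤ with *-≤-splitˡ {b₁ = leaves B₁} {leaves B₂} A≤ ≤T₁ ≤T₂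
...   | inj₁ ≤T = factorisation s t₁ (≤-leaves-node x T₁ T₂ ≤T)
...   | inj₂ ≤T = factorisation s t₂ (≤-leaves-node x T₁ T₂ ≤T)

factorisation-nodeʳ : ∀ {F H x T₁ T₂} → x ∈Var H →
  Factorisation F (restrict H x false) T₁ → Factorisation F (restrict H x true) T₂ →
  Factorisation F H (node x T₁ T₂)
factorisation-nodeʳ {x = x} {T₁} {T₂} x∈H
  (factorisation {A₁} s₁ t₁ ≤T₁) (factorisation {A₂} s₂ t₂ ≤T₂)
  with IsBST-join x∈H t₁ t₂
... | _ , t , B≤ with *-≤-splitʳ {a₁ = leaves A₁} {leaves A₂} B≤ ≤T₁ ≤T₂
...   | inj₁ ≤T = factorisation s₁ t (≤-leaves-node x T₁ T₂ ≤T)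
...   | inj₂ ≤T = factorisation s₂ t (≤-leaves-node x T₁ T₂ ≤T)

factorise : ∀ F H T → NoSharedVars F H → IsBST (F · H) T → Factorisation F H T
factorise F H ε disj (bst-leaf FH∋[]) =
  let F∋[] , H∋[] = ·-hasEmptyClause⁻ F H FH∋[] in
  factorisation (bst-leaf F∋[]) (bst-leaf H∋[]) ≤-refl
factorise F H (node x T₁ T₂) disj (bst-node _ x∈FH u₁ u₂) with ·-∈Var⁻ F H x∈FH
... | inj₁ x∈F = factorisation-nodeˡ x∈F (branch false u₁) (branch true u₂)
  where
  branch : ∀ b {T} → IsBST (restrict (F · H) x b) T → Factorisation (restrict F x b) H T
  branch b u = factorise (restrict F x b) H _ (NoSharedVars-restrictˡ x b disj)
                 (subst (λ G → IsBST G _) (restrict-·ˡ F H b (disj x x∈F)) u)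
... | inj₂ x∈H = factorisation-nodeʳ x∈H (branch false u₁) (branch true u₂)
  where
  branch : ∀ b {T} → IsBST (restrict (F · H) x b) T → Factorisation F (restrict H x b) T
  branch b u = factorise F (restrict H x b) _ (NoSharedVars-restrictʳ x b disj)
                 (subst (λ G → IsBST G _) (restrict-·ʳ F H b (λ x∈F → disj x x∈F x∈H)) u)

lemma5 : (F H : Formula) (TF TH : Tree) →
    NoSharedVars F H → Unsatisfiable F → Unsatisfiable H →
    OptimalBST F TF → OptimalBST H TH →
    OptimalBST (F · H) (replaceLeaves TF TH)
lemma5 F H TF TH disj _ unsatH (sF , optimalF) (tH , optimalH) =
  IsBST-replaceLeaves F H disj H≢[] sF tH , optimal
  where
  H≢[] : H ≢ []
  H≢[] refl = unsatH ((λ _ → true) , [])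

  optimal : ∀ T → IsBST (F · H) T → size (replaceLeaves TF TH) ≤ size T
  optimal T u with factorise F H T disj u
  ... | factorisation {A} {B} s t ≤T = ≤-pred (begin
    leaves (replaceLeaves TF TH)  ≡⟨ leaves-replaceLeaves TF TH ⟩
    leaves TF * leaves TH         ≤⟨ *-mono-≤ (s≤s (optimalF A s)) (s≤s (optimalH B t)) ⟩
    leaves A * leaves B           ≤⟨ ≤T ⟩
    leaves T                      ∎)
    where open ≤-Reasoning
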